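{- Let $\mathcal T_n$ be the set of Cayley trees labelled with $[n]_0$ and $\mathcal{PF}_n$ the set of parking functions of length $n$. The map $\rho_n:\mathcal{PF}_n\to\mathcal T_n$, $\pi\mapsto \mathrm{PT}(\pi)$, is a bijection that is record-preserving, i.e. $\mathrm{Rec}(\pi)=\mathrm{Rec}(\mathrm{PT}(\pi))$ for every $\pi\in\mathcal{PF}_n$. Its inverse is $T\mapsto \pi_T$.
   Context: A Cayley tree labelled with $[n]_0=\{0,\dots,n\}$ is a tree on vertex set $[n]_0$ rooted at $0$, with parent map $f_T:[n]\to[n]_0$. A non-root vertex $k$ is a record if it is the largest label on the path from $k$ to the root; $\mathrm{Rec}(T)$ is the set of records. Weary permutation $\omega_T$: run priority-first search from $0$ (at each step visit the smallest unvisited vertex adjacent to a visited vertex); $\omega_T(i)$ is the $i$-th non-root vertex visited, $\omega_T(0)=0$. The preference sequence of $T$ is $\pi_T=(\pi_T(1),\dots,\pi_T(n))$ with $\pi_T(i)=\omega_T^{ -1}(f_T(i))+1$. A parking function of length $n$ is a sequence $\pi=(a_1,\dots,a_n)$ in $[n]$ such that when cars $1,\dots,n$ enter in order a street with spots $1,\dots,n$, car $i$ parking in the first free spot $j\ge a_i$, all cars park; $\omega_\pi(j)$ is the car in spot $j$, and $\omega_\pi(0)=0$. $\mathrm{Rec}(\pi)$ is the set of left-to-right maxima of the word $\omega_\pi(1)\cdots\omega_\pi(n)$. The parking tree $\mathrm{PT}(\pi)$ is the Cayley tree labelled with $[n]_0$, rooted at $0$, with parent map $f_\pi(i)=\omega_\pi(\pi(i)-1)$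 for $i\in[n]$. -}

module Defs where

open import Data.Nat using (ℕ; zero; suc; _+_; _∸_; _≤_; _<_; _<?_; _≡ᵇ_)
open import Data.Bool using (Bool; true; false; not; _∧_; _∨_; if_then_else_)
open import Data.Fin using (Fin; fromℕ<; toℕ)
open import Data.List using (List; []; _∷_; _++_; [_]; upTo; map; tabulate)
open import Data.Bool.ListAction using (any)
open import Data.Maybe using (Maybe; just; nothing; maybe; fromMaybe; Is-just)
open import Data.Product using (_×_)
open import Relation.Nullary using (yes; no)
open import Relation.Binary.PropositionalEquality using (_≡_)

iter : {A : Set} → ℕ → (A → A) → A → A
iter zero    g x = x
iter (suc m) g x = g (iter m g x)

nth : List ℕ → ℕ → ℕ
nth []       _       = 0
nth (x ∷ _)  zero    = x
nth (_ ∷ xs) (suc i) = nth xs i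

-- position of the first occurrence of x in a list (length of list if absent)
indexOf : ℕ → List ℕ → ℕ
indexOf x []       = 0
indexOf x (y ∷ ys) = if x ≡ᵇ y then 0 else suc (indexOf x ys)

memb : ℕ → List ℕ → Bool
memb x = any (λ y → x ≡ᵇ y)

firstSat : (ℕ → Bool) → List ℕ → Maybe ℕ
firstSat P []       = nothing
firstSat P (x ∷ xs) = if P x then just x else firstSat P xs

oneTo : ℕ → List ℕ
oneTo n = map suc (upTo n)

isSuc : ℕ → Bool
isSuc zero    = false
isSuc (suc _) = true

-- Cayley trees labelled with [n]_0 = {0,...,n}, rooted at 0.
-- A tree is given by its parent map f_T : [n] → [n]_0, encoded as
-- p : Fin n → ℕ where  p i  is the parent of vertex  toℕ i + 1.

-- the parent map extended to all of ℕ (root and out-of-range ↦ 0)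
parent : (n : ℕ) → (Fin n → ℕ) → ℕ → ℕ
parent n p zero = zero
parent n p (suc v) with v <? n
... | yes h = p (fromℕ< h)
... | no _  = zero

IsCayleyTree : (n : ℕ) → (Fin n → ℕ) → Set
IsCayleyTree n p =
  (∀ i → p i ≤ n) × (∀ v → v ≤ n → iter n (parent n p) v ≡ 0)

IsRecT : (n : ℕ) → (Fin n → ℕ) → ℕ → Set
IsRecT n p k = (1 ≤ k) × (k ≤ n) × (∀ m → iter m (parent n p) k ≤ k)

adjB : (n : ℕ) → (Fin n → ℕ) → ℕ → ℕ → Bool
adjB n p u v = (isSuc u ∧ (parent n p u ≡ᵇ v)) ∨ (isSuc v ∧ (parent n p v ≡ᵇ u))

pfs : (n : ℕ) → (Fin n → ℕ) → ℕ → List ℕ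
pfs n p zero    = 0 ∷ []
pfs n p (suc k) with pfs n p k
... | vis with firstSat (λ v → not (memb v vis) ∧ any (λ u → adjB n p u v) vis) (oneTo n)
...   | just v  = vis ++ [ v ]
...   | nothing = vis ++ [ 0 ]

weary : (n : ℕ) → (Fin n → ℕ) → ℕ → ℕ
weary n p i = nth (pfs n p n) i

wearyInv : (n : ℕ) → (Fin n → ℕ) → ℕ → ℕ
wearyInv n p x = indexOf x (pfs n p n)

prefSeq : (n : ℕ) → (Fin n → ℕ) → (Fin n → ℕ)
prefSeq n p i = wearyInv n p (p i) + 1

-- Parking functions. A sequence (a_1,...,a_n) is encoded as a : Fin n → ℕ,
-- a i being the preference of car  toℕ i + 1.  Spots are 1..n.

Occ : Set
Occ = ℕ → Maybe ℕ   -- spot ↦ car parked there (if any)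

setOcc : Occ → ℕ → ℕ → Occ
setOcc occ j c s = if s ≡ᵇ j then just c else occ s

findSpot : Occ → ℕ → ℕ → Maybe ℕ
findSpot occ j zero = nothing
findSpot occ j (suc fuel) with occ j
... | nothing = just j
... | just _  = findSpot occ (suc j) fuel

parkFrom : ℕ → ℕ → List ℕ → Occ → Maybe Occ
parkFrom n c []       occ = just occ
parkFrom n c (x ∷ xs) occ with findSpot occ x (suc n ∸ x)
... | nothing = nothing
... | just j  = parkFrom n (suc c) xs (setOcc occ j c)

park : (n : ℕ) → (Fin n → ℕ) → Maybe Occ
park n a = parkFrom n 1 (tabulate a) (λ _ → nothing)

IsParkingFunction : (n : ℕ) → (Fin n → ℕ) → Set
IsParkingFunction n a = (∀ i → (1 ≤ a i) × (a i ≤ n)) × Is-just (park n a)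

-- ω_π(j): car in spot j;  ω_π(0) = 0
omegaPF : (n : ℕ) → (Fin n → ℕ) → ℕ → ℕ
omegaPF n a j = maybe (λ occ → fromMaybe 0 (occ j)) 0 (park n a)

IsRecPF : (n : ℕ) → (Fin n → ℕ) → ℕ → Set
IsRecPF n a k =
  Data.Product.Σ ℕ λ j → (1 ≤ j) × (j ≤ n) × (omegaPF n a j ≡ k)
    × (∀ j′ → 1 ≤ j′ → j′ < j → omegaPF n a j′ < k)

PT : (n : ℕ) → (Fin n → ℕ) → (Fin n → ℕ)
PT n a i = omegaPF n a (a i ∸ 1)

{-# OPTIONS --safe #-}
module Submission where

-- Parking the cars of a parking function π one at a time keeps an invariant: car d parks in a
-- spot j ≥ π(d), and every spot in [π(d), j) holds a smaller car.  So the parent ω_π(π(d) − 1)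
-- of d in PT(π) sits in an earlier spot, PT(π) is a tree, and the car in spot k + 1 is exactly
-- the smallest unvisited vertex whose parent is among the cars in spots 0, …, k.  Hence the
-- priority-first search of PT(π) visits the vertices in street order, ω_PT(π) = ω_π, which
-- gives π_PT(π) = π.  Records agree because the ancestors of the car in spot j sit in earlier
-- spots, while every car in an earlier spot is bounded by the car itself or by one of its
-- ancestors.  Conversely, for a tree T, parking π_T reproduces the search: car ω_T(j) prefers
-- the spot after its parent's, and each spot in between holds a vertex that the search chose
-- while ω_T(j) was already available, hence a smaller car that has already parked.  So car
-- ω_T(j) parks in spot j and PT(π_T) = T.  Both directions use that an injective self-map of
-- {0, …, n} is onto.

open import Defs
open import Data.Nat using (ℕ; zero; suc; _+_; _∸_; _≤_; _<_; _<?_; _≤?_; _≡ᵇ_; z≤n; s≤s; s≤s⁻¹; z<s)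
open import Data.Nat.Properties
open import Data.Nat.Induction using (<-rec)
open import Data.Bool using (Bool; true; false; not; _∧_; T)
open import Data.Bool.Properties using (T-∧; T-∨)
open import Data.Fin as Fin using (Fin; fromℕ<; toℕ; punchOut)
open import Data.Fin.Properties using (toℕ-fromℕ<; fromℕ<-toℕ; toℕ<n; toℕ-injective; injective⇒≤; punchOut-injective; any?; ¬∀⟶∃¬)
open import Data.List using (List; []; _∷_; _++_; [_]; tabulate; applyUpTo; length)
open import Data.List.Properties using (applyUpTo-∷ʳ; map-upTo; ++-assoc; ++-identityʳ; length-++)
open import Data.List.Relation.Unary.Any.Properties using (any⁺; any⁻; applyUpTo⁺; applyUpTo⁻)
open import Data.Bool.ListAction using (any)
open import Data.Maybe using (Maybe; just; nothing; fromMaybe; Is-just)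
open import Data.Maybe.Properties using (just-injective)
import Data.Maybe.Relation.Unary.Any as Maybe
open import Data.Product using (_×_; _,_; proj₁; proj₂; ∃)
open import Data.Sum using (_⊎_; inj₁; inj₂; [_,_]′)
open import Function using (_∘_; Injective; Equivalence)
open import Relation.Nullary using (yes; no; ¬_; contradiction)
open import Relation.Nullary.Decidable using (T?)
open import Relation.Binary.PropositionalEquality hiding ([_])
open import Relation.Binary.Definitions using (tri<; tri≈; tri>)

-- Pigeonhole principle on initial segments of ℕ

InjectiveOn : ℕ → (ℕ → ℕ) → Set
InjectiveOn m f = ∀ {i j} → i < m → j < m → f i ≡ f j → i ≡ j

injective⇒surjective : ∀ {m} {F : Fin m → Fin m} → Injective _≡_ _≡_ F → ∀ y → ∃ λ x → F x ≡ y
injective⇒surjective {suc m} {F} F-inj y with any? (λ x → F x Fin.≟ y)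
... | yes hit = hit
... | no miss = contradiction (injective⇒≤ G-inj) 1+n≰n
  where
  G : Fin (suc m) → Fin m
  G x = punchOut {i = y} {j = F x} λ y≡Fx → miss (x , sym y≡Fx)
  G-inj : Injective _≡_ _≡_ G
  G-inj Gx≡Gx′ = F-inj (punchOut-injective {i = y} _ _ Gx≡Gx′)

module _ {m m′ : ℕ} (f : ℕ → ℕ) (f-bound : ∀ {i} → i < m → f i < m′) where

  restrict : Fin m → Fin m′
  restrict i = fromℕ< (f-bound (toℕ<n i))

  toℕ-restrict : ∀ i → toℕ (restrict i) ≡ f (toℕ i)
  toℕ-restrict i = toℕ-fromℕ< _

  restrict-injective : InjectiveOn m f → Injective _≡_ _≡_ restrict
  restrict-injective f-inj {i} {j} ri≡rj = toℕ-injective (f-inj (toℕ<n i) (toℕ<n j)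
    (trans (sym (toℕ-restrict i)) (trans (cong toℕ ri≡rj) (toℕ-restrict j))))

injectiveOn⇒surjectiveOn : ∀ {m} (f : ℕ → ℕ) (f-bound : ∀ {i} → i < m → f i < m) →
                           InjectiveOn m f → ∀ {y} → y < m → ∃ λ i → i < m × f i ≡ y
injectiveOn⇒surjectiveOn f f-bound f-inj {y} y<m =
  let x , rx≡y = injective⇒surjective (restrict-injective f f-bound f-inj) (fromℕ< y<m)
  in toℕ x , toℕ<n x , trans (sym (toℕ-restrict f f-bound x)) (trans (cong toℕ rx≡y) (toℕ-fromℕ< y<m))

covering⇒≤ : ∀ {m m′} (f : ℕ → ℕ) → (∀ {v} → v < m′ → ∃ λ i → i < m × f i ≡ v) → m′ ≤ m
covering⇒≤ f cover = injective⇒≤ G-inj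
  where
  G : Fin _ → Fin _
  G v = fromℕ< (proj₁ (proj₂ (cover (toℕ<n v))))
  f-G : ∀ v → f (toℕ (G v)) ≡ toℕ v
  f-G v = trans (cong f (toℕ-fromℕ< _)) (proj₂ (proj₂ (cover (toℕ<n v))))
  G-inj : Injective _≡_ _≡_ G
  G-inj {v} {v′} Gv≡Gv′ = toℕ-injective (trans (sym (f-G v)) (trans (cong (f ∘ toℕ) Gv≡Gv′) (f-G v′)))

crossing : ∀ (Q : ℕ → Bool) N → ¬ T (Q 0) → T (Q N) → ∃ λ m → m < N × ¬ T (Q m) × T (Q (suc m))
crossing Q zero    ¬Q0 Q0 = contradiction Q0 ¬Q0
crossing Q (suc N) ¬Q0 Q[1+N] with T? (Q N)
... | no ¬QN = N , ≤-refl , ¬QN , Q[1+N]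
... | yes QN = let m , m<N , crossed = crossing Q N ¬Q0 QN in m , m<n⇒m<1+n m<N , crossed

any-applyUpTo⁺ : ∀ (g : ℕ → Bool) f {i m} → i < m → T (g (f i)) → T (any g (applyUpTo f m))
any-applyUpTo⁺ g f i<m gfi = any⁺ g (applyUpTo⁺ f gfi i<m)

any-applyUpTo⁻ : ∀ (g : ℕ → Bool) f {m} → T (any g (applyUpTo f m)) → ∃ λ i → i < m × T (g (f i))
any-applyUpTo⁻ g f h = applyUpTo⁻ f (any⁻ g _ h)

memb-applyUpTo⁺ : ∀ f {i m} → i < m → T (memb (f i) (applyUpTo f m))
memb-applyUpTo⁺ f {i} i<m = any-applyUpTo⁺ _ f i<m (≡⇒≡ᵇ (f i) (f i) refl)

memb-applyUpTo⁻ : ∀ f {x m} → T (memb x (applyUpTo f m)) → ∃ λ i → i < m × f i ≡ x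
memb-applyUpTo⁻ f {x} h =
  let i , i<m , x≡ᵇfi = any-applyUpTo⁻ _ f h in i , i<m , sym (≡ᵇ⇒≡ x (f i) x≡ᵇfi)

indexOf-here : ∀ x ys → indexOf x (x ∷ ys) ≡ 0
indexOf-here x ys with x ≡ᵇ x | ≡⇒≡ᵇ x x refl
... | true | _ = refl

indexOf-there : ∀ {x y} ys → x ≢ y → indexOf x (y ∷ ys) ≡ suc (indexOf x ys)
indexOf-there {x} {y} ys x≢y with x ≡ᵇ y in x≡ᵇy
... | false = refl
... | true  = contradiction (≡ᵇ⇒≡ x y (subst T (sym x≡ᵇy) _)) x≢y

indexOf-applyUpTo : ∀ f {i m} → i < m → (∀ {j} → j < i → f j ≢ f i) → indexOf (f i) (applyUpTo f m) ≡ i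
indexOf-applyUpTo f {zero}  {suc m} _         _     = indexOf-here (f 0) (applyUpTo (f ∘ suc) m)
indexOf-applyUpTo f {suc i} {suc m} (s≤s i<m) fresh =
  trans (indexOf-there (applyUpTo (f ∘ suc) m) (fresh z<s ∘ sym)) (cong suc (indexOf-applyUpTo (f ∘ suc) i<m (fresh ∘ s≤s)))

firstSat-applyUpTo : ∀ Q f {m i} → i < m → T (Q (f i)) →
  ∃ λ i₀ → i₀ < m × firstSat Q (applyUpTo f m) ≡ just (f i₀) × T (Q (f i₀)) × (∀ {j} → j < i₀ → ¬ T (Q (f j)))
firstSat-applyUpTo Q f {suc m} {i} i<m Qfi with Q (f 0) in Qf0
... | true = 0 , z<s , refl , subst T (sym Qf0) _ , λ ()
firstSat-applyUpTo Q f {suc m} {zero}  i<m       Qfi | false = contradiction (subst T Qf0 Qfi) λ ()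
firstSat-applyUpTo Q f {suc m} {suc i} (s≤s i<m) Qfi | false =
  let i₀ , i₀<m , found , Qfi₀ , before = firstSat-applyUpTo Q (f ∘ suc) i<m Qfi
  in suc i₀ , s≤s i₀<m , found , Qfi₀ , λ { {zero} _ → subst T Qf0 ; {suc j} (s≤s j<i₀) → before j<i₀ }

record LeastIn (Q : ℕ → Bool) (n w : ℕ) : Set where
  field
    pos       : 1 ≤ w
    bound     : w ≤ n
    satisfies : T (Q w)
    least     : ∀ {u} → 1 ≤ u → u < w → ¬ T (Q u)

firstSat-oneTo : ∀ Q {n v} → 1 ≤ v → v ≤ n → T (Q v) → ∃ λ w → firstSat Q (oneTo n) ≡ just w × LeastIn Q n w
firstSat-oneTo Q {n} {suc v} _ v<n Qv rewrite map-upTo suc n =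
  let i₀ , i₀<n , found , Qw , before = firstSat-applyUpTo Q suc v<n Qv
  in suc i₀ , found , record { pos = s≤s z≤n ; bound = i₀<n ; satisfies = Qw
                             ; least = λ { {suc u} _ (s≤s u<i₀) → before u<i₀ } }

firstSat-oneTo-least : ∀ Q {n w} → LeastIn Q n w → firstSat Q (oneTo n) ≡ just w
firstSat-oneTo-least Q {n} {w} w-least with firstSat-oneTo Q (LeastIn.pos w-least) (LeastIn.bound w-least) (LeastIn.satisfies w-least)
... | w′ , found , w′-least with <-cmp w′ w
... | tri< w′<w _ _ = contradiction (LeastIn.satisfies w′-least) (LeastIn.least w-least (LeastIn.pos w′-least) w′<w)
... | tri≈ _ refl _ = found
... | tri> _ _ w<w′ = contradiction (LeastIn.satisfies w-least) (LeastIn.least w′-least (LeastIn.pos w-least) w<w′)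

-- The parking process

setOcc-here : ∀ occ j c → setOcc occ j c j ≡ just c
setOcc-here occ j c with j ≡ᵇ j | ≡⇒≡ᵇ j j refl
... | true | _ = refl

setOcc-elsewhere : ∀ occ {j} c {s} → s ≢ j → setOcc occ j c s ≡ occ s
setOcc-elsewhere occ {j} c {s} s≢j with s ≡ᵇ j in s≡ᵇj
... | false = refl
... | true  = contradiction (≡ᵇ⇒≡ s j (subst T (sym s≡ᵇj) _)) s≢j

setOcc-just : ∀ occ j c {s d} → setOcc occ j c s ≡ just d → (s ≡ j × d ≡ c) ⊎ occ s ≡ just d
setOcc-just occ j c {s} o with s ≟ j
... | yes refl = inj₁ (refl , just-injective (trans (sym o) (setOcc-here occ j c)))
... | no s≢j   = inj₂ (trans (sym (setOcc-elsewhere occ c s≢j)) o)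

record FirstFreeFrom (occ : Occ) (x y : ℕ) : Set where
  field
    from   : x ≤ y
    free   : occ y ≡ nothing
    passed : ∀ {s} → x ≤ s → s < y → ∃ λ d → occ s ≡ just d

findSpot-sound : ∀ occ x fuel {y} → findSpot occ x fuel ≡ just y → FirstFreeFrom occ x y × y < x + fuel
findSpot-sound occ x (suc fuel) found with occ x in occ-x
findSpot-sound occ x (suc fuel) refl | nothing =
  record { from = ≤-refl ; free = occ-x ; passed = λ x≤s s<x → contradiction (<-≤-trans s<x x≤s) (<-irrefl refl) }
  , m<m+n x z<s
findSpot-sound occ x (suc fuel) {y} found | just d =
  record { from = <⇒≤ from ; free = free ; passed = passed′ } , subst (y <_) (sym (+-suc x fuel)) y<
  where
  open FirstFreeFrom (proj₁ (findSpot-sound occ (suc x) fuel found))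
  y< = proj₂ (findSpot-sound occ (suc x) fuel found)
  passed′ : ∀ {s} → x ≤ s → s < y → ∃ λ d → occ s ≡ just d
  passed′ x≤s s<y with m≤n⇒m<n∨m≡n x≤s
  ... | inj₁ x<s  = passed x<s s<y
  ... | inj₂ refl = d , occ-x

findSpot-complete : ∀ occ x fuel {y} → FirstFreeFrom occ x y → y < x + fuel → findSpot occ x fuel ≡ just y
findSpot-complete occ x zero {y} y-first y< =
  contradiction (<-≤-trans (subst (y <_) (+-identityʳ x) y<) (FirstFreeFrom.from y-first)) (<-irrefl refl)
findSpot-complete occ x (suc fuel) {y} y-first y< with m≤n⇒m<n∨m≡n (FirstFreeFrom.from y-first)
... | inj₂ refl rewrite FirstFreeFrom.free y-first = refl
... | inj₁ x<y with FirstFreeFrom.passed y-first ≤-refl x<y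
... | d , occ-x rewrite occ-x =
  findSpot-complete occ (suc x) fuel
    (record { from = x<y ; free = FirstFreeFrom.free y-first ; passed = FirstFreeFrom.passed y-first ∘ <⇒≤ })
    (subst (y <_) (+-suc x fuel) y<)

findSpot-in-street : ∀ occ n x {y} → findSpot occ x (suc n ∸ x) ≡ just y → y ≤ n
findSpot-in-street occ n x {y} found with findSpot-sound occ x (suc n ∸ x) found | x ≤? suc n
... | _ , y< | yes x≤1+n = s≤s⁻¹ (subst (y <_) (m+[n∸m]≡n x≤1+n) y<)
... | y-first , y< | no x≰1+n = contradiction (FirstFreeFrom.from y-first) (<⇒≱ (subst (y <_) x+0≡x y<))
  where
  x+0≡x : x + (suc n ∸ x) ≡ x
  x+0≡x = trans (cong (x +_) (m≤n⇒m∸n≡0 (<⇒≤ (≰⇒> x≰1+n)))) (+-identityʳ x)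

m+[1+n]≡1+o⇒m≤o : ∀ {m n o} → m + suc n ≡ suc o → m ≤ o
m+[1+n]≡1+o⇒m≤o {m} {n} eq = subst (m ≤_) (suc-injective (trans (sym (+-suc m n)) eq)) (m≤m+n m n)

omegaPF≡ : ∀ n a {O} → park n a ≡ just O → ∀ s → omegaPF n a s ≡ fromMaybe 0 (O s)
omegaPF≡ n a park≡ s rewrite park≡ = refl

prefsFrom : (ℕ → ℕ) → ℕ → ℕ → List ℕ
prefsFrom A c zero    = []
prefsFrom A c (suc m) = A c ∷ prefsFrom A (suc c) m

tabulate≡prefsFrom : ∀ (A : ℕ → ℕ) {m} (g : Fin m → ℕ) c → (∀ i → g i ≡ A (c + toℕ i)) → tabulate g ≡ prefsFrom A c m
tabulate≡prefsFrom A {zero}  g c g≡A = refl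
tabulate≡prefsFrom A {suc m} g c g≡A =
  cong₂ _∷_ (trans (g≡A Fin.zero) (cong A (+-identityʳ c)))
            (tabulate≡prefsFrom A (g ∘ Fin.suc) (suc c) λ i → trans (g≡A (Fin.suc i)) (cong A (+-suc c (toℕ i))))

parkFrom-prefsFrom : ∀ n (A : ℕ → ℕ) c m occ {y} → findSpot occ (A c) (suc n ∸ A c) ≡ just y →
                     parkFrom n c (prefsFrom A c (suc m)) occ ≡ parkFrom n (suc c) (prefsFrom A (suc c) m) (setOcc occ y c)
parkFrom-prefsFrom n A c m occ found rewrite found = refl

module Parking (n : ℕ) (A : ℕ → ℕ) (A-pos : ∀ {d} → 1 ≤ d → d ≤ n → 1 ≤ A d) where

  record Parked (c : ℕ) (occ : Occ) : Set where
    field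
      spot-pos       : ∀ {j d} → occ j ≡ just d → 1 ≤ j
      spot-bound     : ∀ {j d} → occ j ≡ just d → j ≤ n
      car-pos        : ∀ {j d} → occ j ≡ just d → 1 ≤ d
      car-arrived    : ∀ {j d} → occ j ≡ just d → d < c
      pref≤spot      : ∀ {j d} → occ j ≡ just d → A d ≤ j
      spot-unique    : ∀ {j j′ d} → occ j ≡ just d → occ j′ ≡ just d → j ≡ j′
      has-spot       : ∀ {d} → 1 ≤ d → d < c → ∃ λ j → occ j ≡ just d
      passed-smaller : ∀ {j j′ d} → occ j′ ≡ just d → A d ≤ j → j < j′ → ∃ λ d′ → occ j ≡ just d′ × d′ < d

  parked-empty : Parked 1 (λ _ → nothing)
  parked-empty = record
    { spot-pos = λ () ; spot-bound = λ () ; car-pos = λ () ; car-arrived = λ () ; pref≤spot = λ ()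
    ; spot-unique = λ () ; has-spot = λ { (s≤s _) (s≤s ()) } ; passed-smaller = λ () }

  parked-step : ∀ {c occ y} → 1 ≤ c → c ≤ n → Parked c occ → findSpot occ (A c) (suc n ∸ A c) ≡ just y →
                Parked (suc c) (setOcc occ y c)
  parked-step {c} {occ} {y} 1≤c c≤n parked found = record
    { spot-pos = λ o → [ (λ { (refl , refl) → ≤-trans (A-pos 1≤c c≤n) Ac≤y }) , spot-pos ]′ (setOcc-just occ y c o)
    ; spot-bound = λ o → [ (λ { (refl , refl) → y≤n }) , spot-bound ]′ (setOcc-just occ y c o)
    ; car-pos = λ o → [ (λ { (refl , refl) → 1≤c }) , car-pos ]′ (setOcc-just occ y c o)
    ; car-arrived = λ o → [ (λ { (refl , refl) → ≤-refl }) , m<n⇒m<1+n ∘ car-arrived ]′ (setOcc-just occ y c o)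
    ; pref≤spot = λ o → [ (λ { (refl , refl) → Ac≤y }) , pref≤spot ]′ (setOcc-just occ y c o)
    ; spot-unique = unique
    ; has-spot = has-spot′
    ; passed-smaller = passed-smaller′ }
    where
    open Parked parked
    open FirstFreeFrom (proj₁ (findSpot-sound occ (A c) (suc n ∸ A c) found)) renaming (from to Ac≤y)

    y≤n : y ≤ n
    y≤n = findSpot-in-street occ n (A c) found
    occupied≢y : ∀ {s d} → occ s ≡ just d → s ≢ y
    occupied≢y o refl with () ← trans (sym o) free
    unique : ∀ {j j′ d} → setOcc occ y c j ≡ just d → setOcc occ y c j′ ≡ just d → j ≡ j′
    unique o o′ with setOcc-just occ y c o | setOcc-just occ y c o′
    ... | inj₁ (refl , _) | inj₁ (refl , _) = refl
    ... | inj₁ (_ , refl) | inj₂ old′       = contradiction (car-arrived old′) (<-irrefl refl)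
    ... | inj₂ old        | inj₁ (_ , refl) = contradiction (car-arrived old) (<-irrefl refl)
    ... | inj₂ old        | inj₂ old′       = spot-unique old old′
    has-spot′ : ∀ {d} → 1 ≤ d → d < suc c → ∃ λ j → setOcc occ y c j ≡ just d
    has-spot′ 1≤d d<1+c with m≤n⇒m<n∨m≡n (s≤s⁻¹ d<1+c)
    ... | inj₂ refl = y , setOcc-here occ y c
    ... | inj₁ d<c  = let j , o = has-spot 1≤d d<c in j , trans (setOcc-elsewhere occ c (occupied≢y o)) o
    passed-smaller′ : ∀ {j j′ d} → setOcc occ y c j′ ≡ just d → A d ≤ j → j < j′ →
                      ∃ λ d′ → setOcc occ y c j ≡ just d′ × d′ < d
    passed-smaller′ {j} o Ad≤j j<j′ with setOcc-just occ y c o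
    ... | inj₁ (refl , refl) =
      let d′ , o′ = passed Ad≤j j<j′ in d′ , trans (setOcc-elsewhere occ c (occupied≢y o′)) o′ , car-arrived o′
    ... | inj₂ old =
      let d′ , o′ , d′<d = passed-smaller old Ad≤j j<j′ in d′ , trans (setOcc-elsewhere occ c (occupied≢y o′)) o′ , d′<d

  parked-run : ∀ m {c occ O} → c + m ≡ suc n → 1 ≤ c → Parked c occ →
               parkFrom n c (prefsFrom A c m) occ ≡ just O → Parked (suc n) O
  parked-run zero {c} c+0≡1+n _ parked refl = subst (λ c → Parked c _) (trans (sym (+-identityʳ c)) c+0≡1+n) parked
  parked-run (suc m) {c} {occ} c+m≡1+n 1≤c parked done with findSpot occ (A c) (suc n ∸ A c) in found
  ... | just y = parked-run m (trans (sym (+-suc c m)) c+m≡1+n) (s≤s z≤n) (parked-step 1≤c c≤n parked found) done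
    where
    c≤n = m+[1+n]≡1+o⇒m≤o c+m≡1+n

iter-shift : ∀ {A : Set} m (g : A → A) x → iter m g (g x) ≡ iter (suc m) g x
iter-shift zero    g x = refl
iter-shift (suc m) g x = cong g (iter-shift m g x)

parent-suc : ∀ n (p : Fin n → ℕ) {v} (v<n : v < n) → parent n p (suc v) ≡ p (fromℕ< v<n)
parent-suc n p {v} v<n with v <? n
... | yes _   = refl
... | no v≮n = contradiction v<n v≮n

parent-toℕ : ∀ n (p : Fin n → ℕ) i → parent n p (suc (toℕ i)) ≡ p i
parent-toℕ n p i = trans (parent-suc n p (toℕ<n i)) (cong p (fromℕ<-toℕ i (toℕ<n i)))

parent-∘ : ∀ n (p : Fin n → ℕ) (h : ℕ → ℕ) {v} → 1 ≤ v → v ≤ n → parent n (h ∘ p) v ≡ h (parent n p v)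
parent-∘ n p h {suc v} _ v<n = trans (parent-suc n (h ∘ p) v<n) (cong h (sym (parent-suc n p v<n)))

¬T⇒T-not : ∀ {b} → ¬ T b → T (not b)
¬T⇒T-not {false} _  = _
¬T⇒T-not {true}  ¬b = ¬b _

T-not⇒¬T : ∀ {b} → T (not b) → ¬ T b
T-not⇒¬T {false} _ ()

adjB-child : ∀ n p {u v} → 1 ≤ v → parent n p v ≡ u → T (adjB n p u v)
adjB-child n p {u} {suc v} _ pv≡u = Equivalence.from T-∨ (inj₂ (≡⇒≡ᵇ (parent n p (suc v)) u pv≡u))

adjB⁻ : ∀ n p {u v} → T (adjB n p u v) → (1 ≤ u × parent n p u ≡ v) ⊎ (1 ≤ v × parent n p v ≡ u)
adjB⁻ n p {u} {v} adj with Equivalence.to (T-∨ {isSuc u ∧ (parent n p u ≡ᵇ v)}) adj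
adjB⁻ n p {suc u} {v}     _ | inj₁ pu≡ᵇv = inj₁ (s≤s z≤n , ≡ᵇ⇒≡ _ v pu≡ᵇv)
adjB⁻ n p {u}     {suc v} _ | inj₂ pv≡ᵇu = inj₂ (s≤s z≤n , ≡ᵇ⇒≡ _ u pv≡ᵇu)

frontier : (n : ℕ) → (Fin n → ℕ) → List ℕ → ℕ → Bool
frontier n p vis v = not (memb v vis) ∧ any (λ u → adjB n p u v) vis

frontier⁺ : ∀ n p {vis v} → ¬ T (memb v vis) → T (any (λ u → adjB n p u v) vis) → T (frontier n p vis v)
frontier⁺ n p v∉vis adj = Equivalence.from T-∧ (¬T⇒T-not v∉vis , adj)

frontier⁻ : ∀ n p {vis v} → T (frontier n p vis v) → ¬ T (memb v vis) × T (any (λ u → adjB n p u v) vis)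
frontier⁻ n p v∈frontier = let v∉vis , adj = Equivalence.to T-∧ v∈frontier in T-not⇒¬T v∉vis , adj

pfs-suc : ∀ n p k {w} → firstSat (frontier n p (pfs n p k)) (oneTo n) ≡ just w → pfs n p (suc k) ≡ pfs n p k ++ [ w ]
pfs-suc n p k found with pfs n p k
... | vis with firstSat (frontier n p vis) (oneTo n)
pfs-suc n p k refl | vis | just w = refl

pfs-snoc : ∀ n p k → ∃ λ x → pfs n p (suc k) ≡ pfs n p k ++ [ x ]
pfs-snoc n p k with pfs n p k
... | vis with firstSat (frontier n p vis) (oneTo n)
... | just w  = w , refl
... | nothing = 0 , refl

length-pfs : ∀ n p k → length (pfs n p k) ≡ suc k
length-pfs n p zero = refl
length-pfs n p (suc k) =
  let x , snoc = pfs-snoc n p k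
  in trans (cong length snoc) (trans (length-++ (pfs n p k)) (trans (+-comm _ 1) (cong suc (length-pfs n p k))))

pfs-prefix : ∀ n p k m → ∃ λ ys → pfs n p (m + k) ≡ pfs n p k ++ ys
pfs-prefix n p k zero = [] , sym (++-identityʳ _)
pfs-prefix n p k (suc m) =
  let ys , prefix = pfs-prefix n p k m
      x , snoc = pfs-snoc n p (m + k)
  in ys ++ [ x ] , trans snoc (trans (cong (_++ [ x ]) prefix) (++-assoc (pfs n p k) ys [ x ]))

nth-++ : ∀ xs ys {i} → i < length xs → nth (xs ++ ys) i ≡ nth xs i
nth-++ (x ∷ xs) ys {zero}  _         = refl
nth-++ (x ∷ xs) ys {suc i} (s≤s i<) = nth-++ xs ys i<

weary-pfs : ∀ n p {i k} → i ≤ k → k ≤ n → weary n p i ≡ nth (pfs n p k) i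
weary-pfs n p {i} {k} i≤k k≤n =
  let ys , prefix = pfs-prefix n p k (n ∸ k)
  in trans (cong (λ m → nth (pfs n p m) i) (sym (m∸n+n≡m k≤n)))
           (trans (cong (λ l → nth l i) prefix) (nth-++ (pfs n p k) ys (subst (i <_) (sym (length-pfs n p k)) (s≤s i≤k))))

nth-++-[x] : ∀ xs x → nth (xs ++ [ x ]) (length xs) ≡ x
nth-++-[x] []       x = refl
nth-++-[x] (_ ∷ xs) x = nth-++-[x] xs x

applyUpTo-nth : ∀ (xs : List ℕ) → applyUpTo (nth xs) (length xs) ≡ xs
applyUpTo-nth []       = refl
applyUpTo-nth (x ∷ xs) = cong (x ∷_) (applyUpTo-nth xs)

applyUpTo-cong : ∀ {f g : ℕ → ℕ} m → (∀ {i} → i < m → f i ≡ g i) → applyUpTo f m ≡ applyUpTo g m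
applyUpTo-cong zero    f≗g = refl
applyUpTo-cong (suc m) f≗g = cong₂ _∷_ (f≗g z<s) (applyUpTo-cong m (f≗g ∘ s≤s))

pfs≡applyUpTo-weary : ∀ n p {k} → k ≤ n → pfs n p k ≡ applyUpTo (weary n p) (suc k)
pfs≡applyUpTo-weary n p {k} k≤n = begin
  pfs n p k                                          ≡⟨ applyUpTo-nth (pfs n p k) ⟨
  applyUpTo (nth (pfs n p k)) (length (pfs n p k))   ≡⟨ cong (applyUpTo _) (length-pfs n p k) ⟩
  applyUpTo (nth (pfs n p k)) (suc k)                ≡⟨ applyUpTo-cong (suc k) (λ i<1+k → weary-pfs n p (s≤s⁻¹ i<1+k) k≤n) ⟨
  applyUpTo (weary n p) (suc k)                      ∎
  where open ≡-Reasoning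

pfs-follows : ∀ n p (ω : ℕ → ℕ) → ω 0 ≡ 0 →
              (∀ {k} → suc k ≤ n → LeastIn (frontier n p (applyUpTo ω (suc k))) n (ω (suc k))) →
              ∀ {k} → k ≤ n → pfs n p k ≡ applyUpTo ω (suc k)
pfs-follows n p ω ω0≡0 next {zero}  _       = cong [_] (sym ω0≡0)
pfs-follows n p ω ω0≡0 next {suc k} 1+k≤n = begin
  pfs n p (suc k)                      ≡⟨ pfs-suc n p k (trans (cong (λ vis → firstSat (frontier n p vis) (oneTo n)) visited)
                                                                (firstSat-oneTo-least _ (next 1+k≤n))) ⟩
  pfs n p k ++ [ ω (suc k) ]           ≡⟨ cong (_++ [ ω (suc k) ]) visited ⟩
  applyUpTo ω (suc k) ++ [ ω (suc k) ] ≡⟨ applyUpTo-∷ʳ ω (suc k) ⟩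
  applyUpTo ω (suc (suc k))            ∎
  where
  open ≡-Reasoning
  visited = pfs-follows n p ω ω0≡0 next (<⇒≤ 1+k≤n)

wearyInv-applyUpTo : ∀ n p {ω : ℕ → ℕ} → pfs n p n ≡ applyUpTo ω (suc n) → InjectiveOn (suc n) ω →
                     ∀ {i} → i ≤ n → wearyInv n p (ω i) ≡ i
wearyInv-applyUpTo n p {ω} visited ω-inj {i} i≤n =
  trans (cong (indexOf (ω i)) visited)
        (indexOf-applyUpTo ω (s≤s i≤n) λ j<i ωj≡ωi → <-irrefl (ω-inj (<-trans j<i (s≤s i≤n)) (s≤s i≤n) ωj≡ωi) j<i)

-- The parking tree of a parking function

Is-just⇒≡just : ∀ {A : Set} {m : Maybe A} → Is-just m → ∃ λ x → m ≡ just x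
Is-just⇒≡just (Maybe.just _) = _ , refl

module ParkingFunction (n : ℕ) (a : Fin n → ℕ) (pf : IsParkingFunction n a) where

  private
    a-bounds : ∀ i → 1 ≤ a i × a i ≤ n
    a-bounds = proj₁ pf

    O : Occ
    O = proj₁ (Is-just⇒≡just (proj₂ pf))

    park≡ : park n a ≡ just O
    park≡ = proj₂ (Is-just⇒≡just (proj₂ pf))

  -- parent n extends any sequence indexed by [n] to ℕ; here it gives the preference of each car.
  pref : ℕ → ℕ
  pref = parent n a

  pref-pos : ∀ {d} → 1 ≤ d → d ≤ n → 1 ≤ pref d
  pref-pos {suc d} _ d<n = subst (1 ≤_) (sym (parent-suc n a d<n)) (proj₁ (a-bounds _))

  open Parking n pref pref-pos

  parked : Parked (suc n) O
  parked = parked-run n refl (s≤s z≤n) parked-empty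
    (trans (cong (λ prefs → parkFrom n 1 prefs (λ _ → nothing)) (sym (tabulate≡prefsFrom pref a 1 (sym ∘ parent-toℕ n a))))
           park≡)

  open Parked parked

  ω : ℕ → ℕ
  ω s = fromMaybe 0 (O s)

  omegaPF≡ω : ∀ s → omegaPF n a s ≡ ω s
  omegaPF≡ω = omegaPF≡ n a park≡

  -- the spot of car d + 1, shifted into [0, n) for the pigeonhole principle
  spotOf : ℕ → ℕ
  spotOf d with d <? n
  ... | yes d<n = proj₁ (has-spot (s≤s z≤n) (s≤s d<n)) ∸ 1
  ... | no _    = 0

  spotOf-parks : ∀ {d} → d < n → O (suc (spotOf d)) ≡ just (suc d)
  spotOf-parks {d} d<n with d <? n
  ... | no d≮n = contradiction d<n d≮n
  ... | yes d<n′ with has-spot (s≤s z≤n) (s≤s d<n′)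
  ...   | suc j , o = o
  ...   | zero  , o = contradiction (spot-pos o) λ ()

  street-full : ∀ {s} → 1 ≤ s → s ≤ n → O s ≡ just (ω s)
  street-full {suc s} _ s<n with injectiveOn⇒surjectiveOn spotOf spot-bound′ spotOf-injective s<n
    where
    spot-bound′ : ∀ {d} → d < n → spotOf d < n
    spot-bound′ = spot-bound ∘ spotOf-parks
    spotOf-injective : InjectiveOn n spotOf
    spotOf-injective d<n d′<n same =
      suc-injective (just-injective (trans (sym (spotOf-parks d<n)) (trans (cong (O ∘ suc) same) (spotOf-parks d′<n))))
  ... | d , d<n , refl rewrite spotOf-parks d<n = refl

  ω-zero : ω 0 ≡ 0
  ω-zero with O 0 in o
  ... | nothing = refl
  ... | just _  = contradiction (spot-pos o) λ ()

  ω-pos : ∀ {s} → 1 ≤ s → s ≤ n → 1 ≤ ω s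
  ω-pos 1≤s s≤n = car-pos (street-full 1≤s s≤n)

  ω-bound : ∀ s → ω s ≤ n
  ω-bound s with O s in o
  ... | nothing = z≤n
  ... | just _  = s≤s⁻¹ (car-arrived o)

  pref-ω≤ : ∀ {s} → 1 ≤ s → s ≤ n → pref (ω s) ≤ s
  pref-ω≤ 1≤s s≤n = pref≤spot (street-full 1≤s s≤n)

  ω-injective : InjectiveOn (suc n) ω
  ω-injective {zero}  {zero}  _         _         _     = refl
  ω-injective {zero}  {suc j} _         (s≤s j<n) ω0≡ωj = contradiction (subst (1 ≤_) (trans (sym ω0≡ωj) ω-zero) (ω-pos (s≤s z≤n) j<n)) λ ()
  ω-injective {suc i} {zero}  (s≤s i<n) _         ωi≡ω0 = contradiction (subst (1 ≤_) (trans ωi≡ω0 ω-zero) (ω-pos (s≤s z≤n) i<n)) λ ()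
  ω-injective {suc i} {suc j} (s≤s i<n) (s≤s j<n) ωi≡ωj =
    spot-unique (street-full (s≤s z≤n) i<n) (trans (street-full (s≤s z≤n) j<n) (cong just (sym ωi≡ωj)))

  ω-surjective : ∀ {c} → 1 ≤ c → c ≤ n → ∃ λ s → 1 ≤ s × s ≤ n × ω s ≡ c
  ω-surjective 1≤c c≤n = let s , o = has-spot 1≤c (s≤s c≤n) in s , spot-pos o , spot-bound o , cong (fromMaybe 0) o

  ω-passed : ∀ {s j} → 1 ≤ s → s ≤ n → pref (ω s) ≤ j → j < s → ω j < ω s
  ω-passed 1≤s s≤n pref≤j j<s with passed-smaller (street-full 1≤s s≤n) pref≤j j<s
  ... | _ , o , d′<ωs rewrite o = d′<ωs

  parentPT : ℕ → ℕ
  parentPT = parent n (PT n a)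

  parentPT-ω : ∀ {s} → 1 ≤ s → s ≤ n → parentPT (ω s) ≡ ω (pref (ω s) ∸ 1)
  parentPT-ω {s} 1≤s s≤n =
    trans (parent-∘ n a (λ x → omegaPF n a (x ∸ 1)) (ω-pos 1≤s s≤n) (ω-bound s)) (omegaPF≡ω _)

  parentPT-earlier : ∀ {s} → s ≤ n → ∃ λ s′ → s′ ≤ s ∸ 1 × parentPT (ω s) ≡ ω s′
  parentPT-earlier {zero}  _   = 0 , z≤n , trans (cong parentPT ω-zero) (sym ω-zero)
  parentPT-earlier {suc s} s<n = _ , ∸-monoˡ-≤ 1 (pref-ω≤ (s≤s z≤n) s<n) , parentPT-ω (s≤s z≤n) s<n

  ancestors-earlier : ∀ m {s} → s ≤ n → ∃ λ s′ → s′ ≤ s ∸ m × iter m parentPT (ω s) ≡ ω s′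
  ancestors-earlier zero    s≤n = _ , ≤-refl , refl
  ancestors-earlier (suc m) {s} s≤n =
    let s″ , s″≤ , anc = ancestors-earlier m s≤n
        s′ , s′≤ , par = parentPT-earlier (≤-trans s″≤ (≤-trans (m∸n≤m s m) s≤n))
    in s′ , ≤-trans s′≤ (≤-trans (∸-monoˡ-≤ 1 s″≤) (≤-reflexive s∸m∸1≡s∸[1+m])) , trans (cong parentPT anc) par
    where
    s∸m∸1≡s∸[1+m] : s ∸ m ∸ 1 ≡ s ∸ suc m
    s∸m∸1≡s∸[1+m] = trans (∸-+-assoc s m 1) (cong (s ∸_) (+-comm m 1))

  PT-isCayleyTree : IsCayleyTree n (PT n a)
  PT-isCayleyTree = (λ i → subst (_≤ n) (sym (omegaPF≡ω _)) (ω-bound _)) , reaches-root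
    where
    spot-of : ∀ {v} → v ≤ n → ∃ λ s → s ≤ n × ω s ≡ v
    spot-of {zero}  _   = 0 , z≤n , ω-zero
    spot-of {suc _} v≤n = let s , _ , s≤n , ωs≡v = ω-surjective (s≤s z≤n) v≤n in s , s≤n , ωs≡v
    reaches-root : ∀ v → v ≤ n → iter n parentPT v ≡ 0
    reaches-root v v≤n with spot-of v≤n
    ... | s , s≤n , refl with ancestors-earlier n s≤n
    ... | s′ , s′≤s∸n , root = trans root (trans (cong ω (n≤0⇒n≡0 (subst (s′ ≤_) (m≤n⇒m∸n≡0 s≤n) s′≤s∸n))) ω-zero)

  visited-before : ∀ {k s} → s ≤ k → T (memb (ω s) (applyUpTo ω (suc k)))
  visited-before s≤k = memb-applyUpTo⁺ ω (s≤s s≤k)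

  unvisited-later : ∀ {k s} → s ≤ n → ¬ T (memb (ω s) (applyUpTo ω (suc k))) → k < s
  unvisited-later {k} {s} s≤n ωs∉ with k <? s
  ... | yes k<s = k<s
  ... | no k≮s  = contradiction (visited-before (≮⇒≥ k≮s)) ωs∉

  frontier-later : ∀ {k s} → suc k ≤ n → 1 ≤ s → s ≤ n →
                   T (frontier n (PT n a) (applyUpTo ω (suc k)) (ω s)) → ω (suc k) ≤ ω s
  frontier-later {k} {s} 1+k≤n 1≤s s≤n ωs∈ with frontier⁻ n (PT n a) {applyUpTo ω (suc k)} ωs∈
  ... | ωs∉ , adj with m≤n⇒m<n∨m≡n (unvisited-later {k} s≤n ωs∉)
  ...   | inj₂ refl  = ≤-refl
  ...   | inj₁ 1+k<s with any-applyUpTo⁻ (λ u → adjB n (PT n a) u (ω s)) ω {suc k} adj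
  ...     | i , i<1+k , adj-i = [ parent-of-earlier , <⇒≤ ∘ child-of-earlier ]′ (adjB⁻ n (PT n a) adj-i)
    where
    k≤n = <⇒≤ 1+k≤n
    i≤k = s≤s⁻¹ i<1+k

    parent-of-earlier : 1 ≤ ω i × parentPT (ω i) ≡ ω s → ω (suc k) ≤ ω s
    parent-of-earlier (_ , parent-ωi≡ωs) =
      let s′ , s′≤i∸1 , parent-ωi≡ωs′ = parentPT-earlier (≤-trans i≤k k≤n)
          s′≤k = ≤-trans s′≤i∸1 (≤-trans (m∸n≤m i 1) i≤k)
          s≡s′ = ω-injective (s≤s s≤n) (s≤s (≤-trans s′≤k k≤n)) (trans (sym parent-ωi≡ωs) parent-ωi≡ωs′)
      in contradiction (subst (_≤ k) (sym s≡s′) s′≤k) (<⇒≱ (<-trans (n<1+n k) 1+k<s))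

    child-of-earlier : 1 ≤ ω s × parentPT (ω s) ≡ ω i → ω (suc k) < ω s
    child-of-earlier (_ , parent-ωs≡ωi) =
      let parent-spot≡i = ω-injective (s≤s (≤-trans (m∸n≤m _ 1) (≤-trans (pref-ω≤ 1≤s s≤n) s≤n)))
                                      (<-≤-trans i<1+k (s≤s k≤n))
                                      (trans (sym (parentPT-ω 1≤s s≤n)) parent-ωs≡ωi)
          pref≤1+k = ≤-trans (m≤n+m∸n (pref (ω s)) 1) (subst (λ t → suc t ≤ suc k) (sym parent-spot≡i) i<1+k)
      in ω-passed 1≤s s≤n pref≤1+k 1+k<s

  next-visited : ∀ {k} → suc k ≤ n → LeastIn (frontier n (PT n a) (applyUpTo ω (suc k))) n (ω (suc k))
  next-visited {k} 1+k≤n = record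
    { pos       = ω-pos (s≤s z≤n) 1+k≤n
    ; bound     = ω-bound (suc k)
    ; satisfies = frontier⁺ n (PT n a) {applyUpTo ω (suc k)} fresh joined
    ; least     = least
    }
    where
    fresh : ¬ T (memb (ω (suc k)) (applyUpTo ω (suc k)))
    fresh ωk+1∈ = let i , i<1+k , ωi≡ωk+1 = memb-applyUpTo⁻ ω ωk+1∈
                  in <-irrefl (ω-injective (<-≤-trans i<1+k (m≤n⇒m≤1+n 1+k≤n)) (s≤s 1+k≤n) ωi≡ωk+1) i<1+k
    joined : T (any (λ u → adjB n (PT n a) u (ω (suc k))) (applyUpTo ω (suc k)))
    joined = let s′ , s′≤k , par = parentPT-earlier 1+k≤n
             in any-applyUpTo⁺ _ ω (s≤s s′≤k) (adjB-child n (PT n a) (ω-pos (s≤s z≤n) 1+k≤n) par)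
    least : ∀ {v} → 1 ≤ v → v < ω (suc k) → ¬ T (frontier n (PT n a) (applyUpTo ω (suc k)) v)
    least 1≤v v<ωk+1 v∈frontier with ω-surjective 1≤v (≤-trans (<⇒≤ v<ωk+1) (ω-bound (suc k)))
    ... | s , 1≤s , s≤n , refl = <⇒≱ v<ωk+1 (frontier-later 1+k≤n 1≤s s≤n v∈frontier)

  pfs-PT : pfs n (PT n a) n ≡ applyUpTo ω (suc n)
  pfs-PT = pfs-follows n (PT n a) ω ω-zero next-visited ≤-refl

  prefSeq-PT : ∀ i → prefSeq n (PT n a) i ≡ a i
  prefSeq-PT i = begin
    wearyInv n (PT n a) (omegaPF n a (a i ∸ 1)) + 1 ≡⟨ cong (λ v → wearyInv n (PT n a) v + 1) (omegaPF≡ω _) ⟩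
    wearyInv n (PT n a) (ω (a i ∸ 1)) + 1           ≡⟨ cong (_+ 1) (wearyInv-applyUpTo n (PT n a) pfs-PT ω-injective
                                                                      (≤-trans (m∸n≤m (a i) 1) (proj₂ (a-bounds i)))) ⟩
    a i ∸ 1 + 1                                     ≡⟨ m∸n+n≡m (proj₁ (a-bounds i)) ⟩
    a i                                             ∎
    where open ≡-Reasoning

  IsRecPF⇒IsRecT : ∀ {k} → IsRecPF n a k → IsRecT n (PT n a) k
  IsRecPF⇒IsRecT (j , 1≤j , j≤n , refl , earlier<) rewrite omegaPF≡ω j =
    ω-pos 1≤j j≤n , ω-bound j , ancestor≤
    where
    ancestor≤ : ∀ m → iter m parentPT (ω j) ≤ ω j
    ancestor≤ m with ancestors-earlier m j≤n
    ... | zero    , _      , anc = subst (_≤ ω j) (sym (trans anc ω-zero)) z≤n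
    ... | suc s′ , s′<j∸m , anc with m≤n⇒m<n∨m≡n (≤-trans s′<j∸m (m∸n≤m j m))
    ...   | inj₂ refl = ≤-reflexive anc
    ...   | inj₁ s′<j = subst (_≤ ω j) (sym anc) (<⇒≤ (subst (_< ω j) (omegaPF≡ω _) (earlier< (suc s′) (s≤s z≤n) s′<j)))

  -- Cars parked strictly between the spot of the parent of ω s and s are smaller than ω s;
  -- the cars before the parent's spot are handled by recursion on that spot.
  earlier-dominated : ∀ s → s ≤ n → ∀ {j} → 1 ≤ j → j < s → ∃ λ m → ω j ≤ iter m parentPT (ω s)
  earlier-dominated = <-rec _ dominated
    where
    dominated : ∀ s → (∀ {t} → t < s → t ≤ n → ∀ {j} → 1 ≤ j → j < t → ∃ λ m → ω j ≤ iter m parentPT (ω t)) →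
                s ≤ n → ∀ {j} → 1 ≤ j → j < s → ∃ λ m → ω j ≤ iter m parentPT (ω s)
    dominated s@(suc s₀) rec s≤n {j} 1≤j j<s with <-cmp (pref (ω s) ∸ 1) j
    ... | tri< t<j _ _ = 0 , <⇒≤ (ω-passed (s≤s z≤n) s≤n (≤-trans (m≤n+m∸n (pref (ω s)) 1) t<j) j<s)
    ... | tri≈ _ refl _ = 1 , ≤-reflexive (sym (parentPT-ω (s≤s z≤n) s≤n))
    ... | tri> _ _ j<t =
      let t≤s₀ = ∸-monoˡ-≤ 1 (pref-ω≤ (s≤s z≤n) s≤n)
          m , below = rec (s≤s t≤s₀) (≤-trans t≤s₀ (<⇒≤ s≤n)) 1≤j j<t
      in suc m , subst (ω j ≤_) (trans (cong (iter m parentPT) (sym (parentPT-ω (s≤s z≤n) s≤n))) (iter-shift m parentPT (ω s))) below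

  IsRecT⇒IsRecPF : ∀ {k} → IsRecT n (PT n a) k → IsRecPF n a k
  IsRecT⇒IsRecPF (1≤k , k≤n , ancestors≤) with ω-surjective 1≤k k≤n
  ... | j , 1≤j , j≤n , refl = j , 1≤j , j≤n , omegaPF≡ω j , earlier<
    where
    earlier< : ∀ j′ → 1 ≤ j′ → j′ < j → omegaPF n a j′ < ω j
    earlier< j′ 1≤j′ j′<j =
      let m , below = earlier-dominated j j≤n 1≤j′ j′<j
          ωj′≢ωj = λ same → <-irrefl (ω-injective (s≤s (≤-trans (<⇒≤ j′<j) j≤n)) (s≤s j≤n) same) j′<j
      in subst (_< ω j) (sym (omegaPF≡ω j′)) (≤∧≢⇒< (≤-trans below (ancestors≤ m)) ωj′≢ωj)

-- The search order and the preference sequence of a Cayley tree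

module CayleyTree (n : ℕ) (p : Fin n → ℕ) (tree : IsCayleyTree n p) where

  parentT : ℕ → ℕ
  parentT = parent n p

  parentT-bound : ∀ v → parentT v ≤ n
  parentT-bound zero    = z≤n
  parentT-bound (suc v) with v <? n
  ... | yes v<n = proj₁ tree (fromℕ< v<n)
  ... | no _    = z≤n

  W : ℕ → ℕ
  W = weary n p

  W-zero : W 0 ≡ 0
  W-zero = weary-pfs n p z≤n z≤n

  record GoodVisit (i : ℕ) : Set where
    field
      bound          : W i ≤ n
      pos            : 1 ≤ W i
      fresh          : ∀ {i′} → i′ < i → W i′ ≢ W i
      parent-earlier : ∃ λ i′ → i′ < i × parentT (W i) ≡ W i′
      least          : ∀ {v} → 1 ≤ v → v ≤ n → (∀ {i′} → i′ < i → W i′ ≢ v) →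
                       (∃ λ i′ → i′ < i × parentT v ≡ W i′) → W i ≤ v

  Searched : ℕ → Set
  Searched k = ∀ {i} → 1 ≤ i → i ≤ k → GoodVisit i

  module NextVisit {k} (1+k≤n : suc k ≤ n) (searched : Searched k) where

    visited : List ℕ
    visited = applyUpTo W (suc k)

    visited-∋ : ∀ {i v} → i < suc k → W i ≡ v → T (memb v visited)
    visited-∋ i<1+k refl = memb-applyUpTo⁺ W i<1+k

    visited-∈ : ∀ {v} → T (memb v visited) → ∃ λ i → i < suc k × W i ≡ v
    visited-∈ = memb-applyUpTo⁻ W

    0∈visited : T (memb 0 visited)
    0∈visited = visited-∋ z<s W-zero

    unvisited : ∃ λ v → v ≤ n × ¬ T (memb v visited)
    unvisited =
      let v , v∉ = ¬∀⟶∃¬ (suc n) (λ v → T (memb (toℕ v) visited)) (λ v → T? _) all-visited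
      in toℕ v , s≤s⁻¹ (toℕ<n v) , v∉
      where
      all-visited : ¬ (∀ (v : Fin (suc n)) → T (memb (toℕ v) visited))
      all-visited ∀visited = <⇒≱ 1+k≤n (s≤s⁻¹ (covering⇒≤ W λ {v} v<1+n →
        visited-∈ (subst (λ v → T (memb v visited)) (toℕ-fromℕ< v<1+n) (∀visited (fromℕ< v<1+n)))))

    frontier-nonempty : ∃ λ u → 1 ≤ u × u ≤ n × T (frontier n p visited u)
    frontier-nonempty with unvisited
    ... | v , v≤n , v∉ with crossing (λ m → memb (iter m parentT v) visited) n v∉
                              (subst (λ u → T (memb u visited)) (sym (proj₂ tree v v≤n)) 0∈visited)
    ... | m , _ , u∉ , parent∈ = boundary (iter m parentT v) (ancestor-bound m) u∉ parent∈
      where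
      ancestor-bound : ∀ m → iter m parentT v ≤ n
      ancestor-bound zero    = v≤n
      ancestor-bound (suc m) = parentT-bound (iter m parentT v)
      boundary : ∀ u → u ≤ n → ¬ T (memb u visited) → T (memb (parentT u) visited) → ∃ λ u → 1 ≤ u × u ≤ n × T (frontier n p visited u)
      boundary zero    _   0∉ _ = contradiction 0∈visited 0∉
      boundary (suc u) u<n u∉ parent∈ =
        let i , i<1+k , Wi≡parent = visited-∈ parent∈
        in suc u , s≤s z≤n , u<n ,
           frontier⁺ n p {visited} u∉ (any-applyUpTo⁺ (λ u′ → adjB n p u′ (suc u)) W i<1+k (adjB-child n p (s≤s z≤n) (sym Wi≡parent)))

    next : ∃ λ w → firstSat (frontier n p visited) (oneTo n) ≡ just w × LeastIn (frontier n p visited) n w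
    next = let u , 1≤u , u≤n , u∈ = frontier-nonempty in firstSat-oneTo (frontier n p visited) 1≤u u≤n u∈

    W-next : ∀ {w} → firstSat (frontier n p visited) (oneTo n) ≡ just w → W (suc k) ≡ w
    W-next {w} found = begin
      W (suc k)                                     ≡⟨ weary-pfs n p ≤-refl 1+k≤n ⟩
      nth (pfs n p (suc k)) (suc k)                 ≡⟨ cong (λ l → nth l (suc k)) (pfs-suc n p k found′) ⟩
      nth (pfs n p k ++ [ w ]) (suc k)              ≡⟨ cong (nth (pfs n p k ++ [ w ])) (length-pfs n p k) ⟨
      nth (pfs n p k ++ [ w ]) (length (pfs n p k)) ≡⟨ nth-++-[x] (pfs n p k) w ⟩
      w                                             ∎
      where
      open ≡-Reasoning
      found′ : firstSat (frontier n p (pfs n p k)) (oneTo n) ≡ just w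
      found′ = trans (cong (λ vis → firstSat (frontier n p vis) (oneTo n)) (pfs≡applyUpTo-weary n p (<⇒≤ 1+k≤n))) found

    module _ {w} (w-first : LeastIn (frontier n p visited) n w) where
      open LeastIn w-first

      w∉ : ¬ T (memb w visited)
      w∉ = proj₁ (frontier⁻ n p {visited} satisfies)

      no-visited-child : ∀ {i} → i < suc k → 1 ≤ W i → parentT (W i) ≢ w
      no-visited-child {zero}  _     1≤W0 _ = contradiction (subst (1 ≤_) W-zero 1≤W0) λ ()
      no-visited-child {suc i} i<1+k _ parent-Wi≡w =
        let i′ , i′<i , parent-Wi≡Wi′ = GoodVisit.parent-earlier (searched (s≤s z≤n) (s≤s⁻¹ i<1+k))
        in w∉ (visited-∋ (<-trans i′<i i<1+k) (trans (sym parent-Wi≡Wi′) parent-Wi≡w))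

      parent-w : ∃ λ i′ → i′ < suc k × parentT w ≡ W i′
      parent-w with any-applyUpTo⁻ (λ u → adjB n p u w) W {suc k} (proj₂ (frontier⁻ n p {visited} satisfies))
      ... | i , i<1+k , adj with adjB⁻ n p adj
      ...   | inj₂ (_ , parent-w≡Wi)      = i , i<1+k , parent-w≡Wi
      ...   | inj₁ (1≤Wi , parent-Wi≡w) = contradiction parent-Wi≡w (no-visited-child i<1+k 1≤Wi)

      w-least : ∀ {v} → 1 ≤ v → v ≤ n → (∀ {i′} → i′ < suc k → W i′ ≢ v) →
                (∃ λ i′ → i′ < suc k × parentT v ≡ W i′) → w ≤ v
      w-least {v} 1≤v v≤n v-new (i′ , i′<1+k , parent-v≡Wi′) =
        ≮⇒≥ λ v<w → least 1≤v v<w (frontier⁺ n p {visited} v∉ v-adj)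
        where
        v∉ : ¬ T (memb v visited)
        v∉ v∈ = let i , i<1+k , Wi≡v = visited-∈ v∈ in v-new i<1+k Wi≡v
        v-adj : T (any (λ u → adjB n p u v) visited)
        v-adj = any-applyUpTo⁺ (λ u → adjB n p u v) W i′<1+k (adjB-child n p 1≤v parent-v≡Wi′)

      good-visit-at : W (suc k) ≡ w → GoodVisit (suc k)
      good-visit-at W-next = record
        { bound          = subst (_≤ n) (sym W-next) bound
        ; pos            = subst (1 ≤_) (sym W-next) pos
        ; fresh          = λ i′<1+k Wi′≡W[1+k] → w∉ (visited-∋ i′<1+k (trans Wi′≡W[1+k] W-next))
        ; parent-earlier = let i′ , i′<1+k , par = parent-w in i′ , i′<1+k , trans (cong parentT W-next) par
        ; least          = λ 1≤v v≤n v-new v-parent → subst (_≤ _) (sym W-next) (w-least 1≤v v≤n v-new v-parent)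
        }

    good-visit : GoodVisit (suc k)
    good-visit = let w , found , w-first = next in good-visit-at w-first (W-next found)

  searched : ∀ {k} → k ≤ n → Searched k
  searched {zero}  _     1≤i i≤0 = contradiction (≤-trans 1≤i i≤0) λ ()
  searched {suc k} 1+k≤n 1≤i i≤1+k with m≤n⇒m<n∨m≡n i≤1+k
  ... | inj₁ i<1+k = searched (<⇒≤ 1+k≤n) 1≤i (s≤s⁻¹ i<1+k)
  ... | inj₂ refl  = NextVisit.good-visit 1+k≤n (searched (<⇒≤ 1+k≤n))

  visit : ∀ {i} → 1 ≤ i → i ≤ n → GoodVisit i
  visit = searched ≤-refl

  W-bound : ∀ {i} → i ≤ n → W i ≤ n
  W-bound {zero}  _   = subst (_≤ n) (sym W-zero) z≤n
  W-bound {suc i} i<n = GoodVisit.bound (visit (s≤s z≤n) i<n)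

  W-injective : InjectiveOn (suc n) W
  W-injective {i} {j} i<1+n j<1+n Wi≡Wj with <-cmp i j
  ... | tri< i<j _ _ = contradiction Wi≡Wj (GoodVisit.fresh (visit (≤-trans (s≤s z≤n) i<j) (s≤s⁻¹ j<1+n)) i<j)
  ... | tri≈ _ i≡j _ = i≡j
  ... | tri> _ _ j<i = contradiction (sym Wi≡Wj) (GoodVisit.fresh (visit (≤-trans (s≤s z≤n) j<i) (s≤s⁻¹ i<1+n)) j<i)

  time-of : ∀ {c} → 1 ≤ c → c ≤ n → ∃ λ j → 1 ≤ j × j ≤ n × W j ≡ c
  time-of 1≤c c≤n with injectiveOn⇒surjectiveOn W (s≤s ∘ W-bound ∘ s≤s⁻¹) W-injective (s≤s c≤n)
  ... | zero  , _ , W0≡c = contradiction (subst (1 ≤_) (trans (sym W0≡c) W-zero) 1≤c) λ ()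
  ... | suc j , j<1+n , Wj≡c = suc j , s≤s z≤n , s≤s⁻¹ j<1+n , Wj≡c

  pfs-W : pfs n p n ≡ applyUpTo W (suc n)
  pfs-W = pfs≡applyUpTo-weary n p ≤-refl

  pref : ℕ → ℕ
  pref = parent n (prefSeq n p)

  pref-W : ∀ {j} → 1 ≤ j → j ≤ n → ∃ λ i′ → i′ < j × parentT (W j) ≡ W i′ × pref (W j) ≡ suc i′
  pref-W {j} 1≤j j≤n =
    let i′ , i′<j , parent≡ = GoodVisit.parent-earlier (visit 1≤j j≤n)
    in i′ , i′<j , parent≡ , (begin
      pref (W j)                       ≡⟨ parent-∘ n p (λ v → wearyInv n p v + 1) (GoodVisit.pos (visit 1≤j j≤n)) (W-bound j≤n) ⟩
      wearyInv n p (parentT (W j)) + 1 ≡⟨ cong (λ v → wearyInv n p v + 1) parent≡ ⟩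
      wearyInv n p (W i′) + 1          ≡⟨ cong (_+ 1) (wearyInv-applyUpTo n p pfs-W W-injective (≤-trans (<⇒≤ i′<j) j≤n)) ⟩
      i′ + 1                           ≡⟨ +-comm i′ 1 ⟩
      suc i′                           ∎)
    where open ≡-Reasoning

  record ParkedInSearchOrder (c : ℕ) (occ : Occ) : Set where
    field
      arrived    : ∀ {s} → 1 ≤ s → s ≤ n → W s < c → occ s ≡ just (W s)
      waiting    : ∀ {s} → 1 ≤ s → s ≤ n → c ≤ W s → occ s ≡ nothing
      spot0-free : occ 0 ≡ nothing

  parkedInSearchOrder-empty : ParkedInSearchOrder 1 (λ _ → nothing)
  parkedInSearchOrder-empty = record
    { arrived = λ 1≤s s≤n Ws<1 → contradiction (GoodVisit.pos (visit 1≤s s≤n)) (<⇒≱ Ws<1)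
    ; waiting = λ _ _ _ → refl
    ; spot0-free = refl }

  parkedInSearchOrder-step : ∀ {c occ} → 1 ≤ c → c ≤ n → ParkedInSearchOrder c occ →
    ∃ λ y → findSpot occ (pref c) (suc n ∸ pref c) ≡ just y × ParkedInSearchOrder (suc c) (setOcc occ y c)
  parkedInSearchOrder-step {c} {occ} 1≤c c≤n parked with time-of 1≤c c≤n
  ... | j , 1≤j , j≤n , refl with pref-W 1≤j j≤n
  ... | i′ , i′<j , parent≡ , pref≡ = j , found , record { arrived = arrived′ ; waiting = waiting′ ; spot0-free = spot0-free′ }
    where
    open ParkedInSearchOrder parked
    -- W j was unvisited at time s although its parent W i′ was visited, so the search preferred W s.
    passed-earlier : ∀ {s} → suc i′ ≤ s → s < j → W s < W j
    passed-earlier {s} i′<s s<j =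
      let s≤n = ≤-trans (<⇒≤ s<j) j≤n
          1≤s = ≤-trans (s≤s z≤n) i′<s
      in ≤∧≢⇒< (GoodVisit.least (visit 1≤s s≤n) (GoodVisit.pos (visit 1≤j j≤n)) (W-bound j≤n)
                 (λ i<s Wi≡Wj → <-irrefl (W-injective (<-trans i<s (s≤s s≤n)) (s≤s j≤n) Wi≡Wj) (<-trans i<s s<j))
                 (i′ , i′<s , parent≡))
               (λ Ws≡Wj → <-irrefl (W-injective (s≤s s≤n) (s≤s j≤n) Ws≡Wj) s<j)
    found : findSpot occ (pref (W j)) (suc n ∸ pref (W j)) ≡ just j
    found rewrite pref≡ = findSpot-complete occ (suc i′) (suc n ∸ suc i′)
      (record { from = i′<j ; free = waiting 1≤j j≤n ≤-refl
              ; passed = λ {s} i′<s s<j → W s , arrived (≤-trans (s≤s z≤n) i′<s) (≤-trans (<⇒≤ s<j) j≤n) (passed-earlier i′<s s<j) })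
      (subst (j <_) (sym (m+[n∸m]≡n (≤-trans i′<j (m≤n⇒m≤1+n j≤n)))) (s≤s j≤n))
    arrived′ : ∀ {s} → 1 ≤ s → s ≤ n → W s < suc (W j) → setOcc occ j (W j) s ≡ just (W s)
    arrived′ {s} 1≤s s≤n Ws≤Wj with m≤n⇒m<n∨m≡n (s≤s⁻¹ Ws≤Wj)
    ... | inj₁ Ws<Wj = trans (setOcc-elsewhere occ (W j) λ { refl → <-irrefl refl Ws<Wj }) (arrived 1≤s s≤n Ws<Wj)
    ... | inj₂ Ws≡Wj with W-injective (s≤s s≤n) (s≤s j≤n) Ws≡Wj
    ...   | refl = setOcc-here occ s (W s)
    waiting′ : ∀ {s} → 1 ≤ s → s ≤ n → suc (W j) ≤ W s → setOcc occ j (W j) s ≡ nothing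
    waiting′ 1≤s s≤n Wj<Ws = trans (setOcc-elsewhere occ (W j) λ { refl → <-irrefl refl Wj<Ws }) (waiting 1≤s s≤n (<⇒≤ Wj<Ws))
    spot0-free′ : setOcc occ j (W j) 0 ≡ nothing
    spot0-free′ = trans (setOcc-elsewhere occ (W j) λ 0≡j → contradiction (subst (1 ≤_) (sym 0≡j) 1≤j) λ ()) spot0-free

  parkedInSearchOrder-run : ∀ m {c occ} → c + m ≡ suc n → 1 ≤ c → ParkedInSearchOrder c occ →
    ∃ λ O → parkFrom n c (prefsFrom pref c m) occ ≡ just O × ParkedInSearchOrder (suc n) O
  parkedInSearchOrder-run zero {c} {occ} c+0≡1+n _ parked =
    occ , refl , subst (λ c → ParkedInSearchOrder c occ) (trans (sym (+-identityʳ c)) c+0≡1+n) parked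
  parkedInSearchOrder-run (suc m) {c} {occ} c+m≡1+n 1≤c parked =
    let y , found , parked′ = parkedInSearchOrder-step 1≤c c≤n parked
        O , done , parkedO = parkedInSearchOrder-run m (trans (sym (+-suc c m)) c+m≡1+n) (s≤s z≤n) parked′
    in O , trans (parkFrom-prefsFrom n pref c m occ found) done , parkedO
    where
    c≤n = m+[1+n]≡1+o⇒m≤o c+m≡1+n

  car-in-spot : ∀ {O} → ParkedInSearchOrder (suc n) O → ∀ {s} → s ≤ n → fromMaybe 0 (O s) ≡ W s
  car-in-spot parked {zero}  _   rewrite ParkedInSearchOrder.spot0-free parked = sym W-zero
  car-in-spot parked {suc s} s<n rewrite ParkedInSearchOrder.arrived parked (s≤s z≤n) s<n (s≤s (W-bound s<n)) = refl

  park-prefSeq : ∃ λ O → park n (prefSeq n p) ≡ just O × ParkedInSearchOrder (suc n) O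
  park-prefSeq =
    let O , done , parkedO = parkedInSearchOrder-run n refl (s≤s z≤n) parkedInSearchOrder-empty
    in O , trans (cong (λ prefs → parkFrom n 1 prefs (λ _ → nothing))
                       (tabulate≡prefsFrom pref (prefSeq n p) 1 (sym ∘ parent-toℕ n (prefSeq n p))))
                 done
         , parkedO

  pref-car : ∀ i → ∃ λ i′ → i′ < n × parentT (suc (toℕ i)) ≡ W i′ × prefSeq n p i ≡ suc i′
  pref-car i =
    let j , 1≤j , j≤n , Wj≡c = time-of (s≤s z≤n) (toℕ<n i)
        i′ , i′<j , parent≡ , pref≡ = pref-W 1≤j j≤n
    in i′ , <-≤-trans i′<j j≤n , subst (λ c → parentT c ≡ W i′) Wj≡c parent≡
     , trans (sym (parent-toℕ n (prefSeq n p) i)) (subst (λ c → pref c ≡ suc i′) Wj≡c pref≡)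

  prefSeq-isParkingFunction : IsParkingFunction n (prefSeq n p)
  prefSeq-isParkingFunction =
    (λ i → let i′ , i′<n , _ , pref≡ = pref-car i in subst (λ x → 1 ≤ x × x ≤ n) (sym pref≡) (s≤s z≤n , i′<n))
    , subst Is-just (sym (proj₁ (proj₂ park-prefSeq))) (Maybe.just _)

  PT-prefSeq : ∀ i → PT n (prefSeq n p) i ≡ p i
  PT-prefSeq i =
    let O , park≡ , parkedO = park-prefSeq
        i′ , i′<n , parent≡ , pref≡ = pref-car i
    in begin
      omegaPF n (prefSeq n p) (prefSeq n p i ∸ 1) ≡⟨ omegaPF≡ n (prefSeq n p) park≡ _ ⟩
      fromMaybe 0 (O (prefSeq n p i ∸ 1))         ≡⟨ cong (λ x → fromMaybe 0 (O (x ∸ 1))) pref≡ ⟩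
      fromMaybe 0 (O i′)                          ≡⟨ car-in-spot parkedO (<⇒≤ i′<n) ⟩
      W i′                                        ≡⟨ parent≡ ⟨
      parentT (suc (toℕ i))                       ≡⟨ parent-toℕ n p i ⟩
      p i                                         ∎
    where open ≡-Reasoning

theorem3p13 : (n : ℕ) →
      -- ρ_n maps PF_n into T_n
      (∀ a → IsParkingFunction n a → IsCayleyTree n (PT n a))
    × (∀ T → IsCayleyTree n T → IsParkingFunction n (prefSeq n T))
      -- T ↦ π_T is a two-sided inverse of ρ_n
    × (∀ a → IsParkingFunction n a → ∀ i → prefSeq n (PT n a) i ≡ a i)
    × (∀ T → IsCayleyTree n T → ∀ i → PT n (prefSeq n T) i ≡ T i)
      -- record preservation: Rec(π) = Rec(PT(π))
    × (∀ a → IsParkingFunction n a → ∀ k →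
         (IsRecPF n a k → IsRecT n (PT n a) k) × (IsRecT n (PT n a) k → IsRecPF n a k))
theorem3p13 n =
    PT-isCayleyTree n
  , prefSeq-isParkingFunction n
  , prefSeq-PT n
  , PT-prefSeq n
  , λ a pf k → IsRecPF⇒IsRecT n a pf , IsRecT⇒IsRecPF n a pf
  where
  open ParkingFunction
  open CayleyTree
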